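{- Let $v_1,\dots,v_n$ be nonnegative integers. There exists a monotone triangle of order $n$ in which, for each $k=1,\dots,n$, the integer $k$ occurs exactly $v_k$ times as an entry, if and only if $(v_1,v_2,\dots,v_n)\preceq(n,n-1,\dots,2,1)$.
   Context: A monotone triangle of order $n$ is a triangular array with $n$ rows, row $k$ (from the top) having $k$ entries, arranged in the usual staggered way, with entries from $\{1,\dots,n\}$, such that entries in each row are strictly increasing from left to right and entries along each north-east diagonal line and each south-east diagonal line are weakly increasing. A vector $x$ is majorized by $y$, written $x\preceq y$, if for every $k=1,\dots,n$, $\sum_{i=1}^k x^{\downarrow}_i\le\sum_{i=1}^k y^{\downarrow}_i$, with equality for $k=n$, where $x^{\downarrow}_i$ is the $i$-th largest entry of $x$. -}

module Defs where

open import Data.Nat using (ℕ; zero; suc; _+_; _≤_; _<_; _≟_)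
open import Data.Nat.Properties using (≤-decTotalOrder)
open import Data.Fin using (Fin; toℕ)
open import Data.List using (List; []; _∷_; reverse; take; downFrom; map; tabulate)
open import Data.Nat.ListAction using (sum)
open import Relation.Binary.PropositionalEquality using (_≡_)
open import Relation.Nullary using (does)
open import Data.Bool using (if_then_else_)
open import Data.Product using (_×_)
import Data.List.Sort as Sort

-- A triangular array is given by a function T i j, where i is the row
-- (0-based, from the top, i = 0 .. n-1) and j the position in the row
-- (0-based, j = 0 .. i).  Values outside this range are irrelevant.
Array : Set
Array = ℕ → ℕ → ℕ

-- Monotone triangle of order n, staggered layout: entry (i , j) sits
-- between entries (i+1 , j) and (i+1 , j+1) of the next row.
record MonotoneTriangle (n : ℕ) (T : Array) : Set where
  field
    entry-≥1 : ∀ i j → i < n → j ≤ i → 1 ≤ T i j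
    entry-≤n : ∀ i j → i < n → j ≤ i → T i j ≤ n
    row-strict : ∀ i j → i < n → suc j ≤ i → T i j < T i (suc j)
    ne-diag : ∀ i j → suc i < n → j ≤ i → T (suc i) j ≤ T i j
    se-diag : ∀ i j → suc i < n → j ≤ i → T i j ≤ T (suc i) (suc j)

countRow : Array → ℕ → ℕ → ℕ → ℕ
countRow T i zero    k = if does (T i zero ≟ k) then 1 else 0
countRow T i (suc j) k = countRow T i j k + (if does (T i (suc j) ≟ k) then 1 else 0)

occurrences : Array → ℕ → ℕ → ℕ
occurrences T zero    k = 0
occurrences T (suc m) k = occurrences T m k + countRow T m m k

open Sort ≤-decTotalOrder using (sort)

decreasing : List ℕ → List ℕ
decreasing xs = reverse (sort xs)

_⪯⟨_⟩_ : List ℕ → ℕ → List ℕ → Set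
x ⪯⟨ n ⟩ y =
  (∀ k → 1 ≤ k → k ≤ n → sum (take k (decreasing x)) ≤ sum (take k (decreasing y)))
  × (sum (take n (decreasing x)) ≡ sum (take n (decreasing y)))

staircase : ℕ → List ℕ
staircase n = map suc (downFrom n)

-- the list (v_1 , ... , v_n) from v : Fin n → ℕ  (v_k is  v (k-1))
vecList : ∀ {n} → (Fin n → ℕ) → List ℕ
vecList v = tabulate v

-- Say k occurs x times and k + 1 occurs y ≤ x times in a monotone triangle. Since a row
-- contains each value at most once, at least x − y rows contain k but not k + 1, and in such a
-- row some k can be raised to k + 1: walk from it down its south-east diagonal while the entries
-- stay k, then up its north-east diagonal while they stay k. Every k met lies in a row without
-- k + 1, and the last one can be raised, since its diagonal neighbours (i + 1, j + 1) and
-- (i − 1, j), which bound it from above, are not k. Repeating, any m ≤ x − y occurrences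
-- move from k to k + 1; in particular adjacent entries of the occurrence vector can be swapped
-- when the first is the larger one.
--
-- Necessity: by such swaps the occurrence vector can be sorted increasingly, and then the sum of
-- its k largest entries counts the entries with values n − k + 1, …, n. Row i contains at most
-- min(k, i + 1) of them, which sums to n + (n − 1) + ⋯ + (n − k + 1), with equality for k = n.
--
-- Sufficiency: a decreasing vector (a, w) majorized by (n, …, 1) is realized by induction on n.
-- If a = n, add a diagonal of 1s to a triangle for w with all entries increased by 1. Otherwise
-- realize (a + 1, w'), where w' is w with one unit removed at the first position where the
-- majorization inequality is tight, and move that unit back by transfers. Finally, every
-- rearrangement of a decreasing vector is reached by swaps.

module Submission where

open import Defs

open import Data.Nat
open import Data.Nat.ListAction using (sum)
open import Data.Nat.Properties
open import Algebra.Properties.CommutativeSemigroup +-commutativeSemigroup using (interchange; xy∙z≈xz∙y)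
open import Data.Bool using (true; false; if_then_else_)
open import Data.Empty using (⊥)
open import Data.Fin using (Fin; toℕ; zero; suc)
open import Data.List
  using (List; []; _∷_; [_]; _++_; length; head; take; map; downFrom; tabulate; reverse; reverseAcc)
open import Data.List.Properties
  using ( length-++; ++-assoc; length-map; length-downFrom; length-tabulate; length-reverse
        ; reverse-involutive; take-all)
open import Data.List.Relation.Binary.Permutation.Propositional using (_↭_; ↭-trans; ↭-sym; ↭⇒↭ₛ)
open import Data.List.Relation.Binary.Permutation.Propositional.Properties using (↭-reverse; ↭-length)
open import Data.List.Relation.Binary.Pointwise using (Pointwise-≡⇒≡)
open import Data.List.Relation.Unary.Linked as Linked using (Linked; []; [-]; _∷_; _∷′_; head′)
open import Data.List.Relation.Unary.Sorted.TotalOrder.Properties using (↗↭↗⇒≋)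
open import Data.List.Sort ≤-decTotalOrder using (sort; sort-↭; sort-↗)
open import Data.Maybe.Relation.Binary.Connected as Connected using (Connected; just-nothing)
open import Data.Product using (Σ; ∃-syntax; _×_; _,_)
open import Data.Sum using (_⊎_; inj₁; inj₂)
open import Data.Unit using (⊤; tt)
open import Function using (id; flip; _∘_)
open import Function.Bundles using (_⇔_; mk⇔)
open import Relation.Binary.Definitions using (tri<; tri≈; tri>)
open import Relation.Binary.PropositionalEquality hiding ([_])
open import Relation.Nullary using (¬_; yes; no; does; contradiction)
open import Relation.Nullary.Decidable using (dec-true; dec-false)
open import Relation.Nullary.Reflects using (ofⁿ)
import Relation.Binary.Construct.Flip.EqAndOrd as Converse

module Insertion where
  open import Data.List.Sort.InsertionSort.Base ≤-decTotalOrder public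
  open import Data.List.Sort.InsertionSort.Properties ≤-decTotalOrder public using (sort-↭; sort-↗)

module Descending where
  open import Data.List.Sort.InsertionSort.Base (Converse.decTotalOrder ≤-decTotalOrder) public
  open import Data.List.Sort.InsertionSort.Properties (Converse.decTotalOrder ≤-decTotalOrder) public
    using (sort-↭; sort-↗)

-- Counting occurrences

-- Written as in Defs.countRow, so that countRow T i (suc j) x reduces to
-- countRow T i j x + δ (T i (suc j)) x.
δ : ℕ → ℕ → ℕ
δ a b = if does (a ≟ b) then 1 else 0

δ-≡ : ∀ {a b} → a ≡ b → δ a b ≡ 1
δ-≡ {a} {b} a≡b rewrite dec-true (a ≟ b) a≡b = refl

δ-≢ : ∀ {a b} → a ≢ b → δ a b ≡ 0
δ-≢ {a} {b} a≢b rewrite dec-false (a ≟ b) a≢b = refl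

δ≤1 : ∀ a b → δ a b ≤ 1
δ≤1 a b with a ≟ b
... | yes a≡b = ≤-reflexive (δ-≡ a≡b)
... | no  a≢b = subst (_≤ 1) (sym (δ-≢ a≢b)) z≤n

δ>0⇒≡ : ∀ {a b} → 0 < δ a b → a ≡ b
δ>0⇒≡ {a} {b} δ>0 with a ≟ b
... | yes a≡b = a≡b
... | no  a≢b = contradiction (subst (0 <_) (δ-≢ a≢b) δ>0) (<-irrefl refl)

module _ {n : ℕ} {T : Array} (mt : MonotoneTriangle n T) where
  open MonotoneTriangle mt

  row-≤ : ∀ {i a b} → i < n → a ≤ b → b ≤ i → T i a ≤ T i b
  row-< : ∀ {i a b} → i < n → a < b → b ≤ i → T i a < T i b

  row-≤ i<n a≤b b≤i with m≤n⇒m<n∨m≡n a≤b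
  ... | inj₁ a<b  = <⇒≤ (row-< i<n a<b b≤i)
  ... | inj₂ refl = ≤-refl

  row-< {b = suc b} i<n (s≤s a≤b) 1+b≤i =
    ≤-<-trans (row-≤ i<n a≤b (≤-trans (n≤1+n b) 1+b≤i)) (row-strict _ b i<n 1+b≤i)

countRow≡0 : ∀ T i j x → (∀ j' → j' ≤ j → T i j' ≢ x) → countRow T i j x ≡ 0
countRow≡0 T i zero    x ∉ = δ-≢ (∉ 0 z≤n)
countRow≡0 T i (suc j) x ∉ =
  cong₂ _+_ (countRow≡0 T i j x (λ j' j'≤j → ∉ j' (m≤n⇒m≤1+n j'≤j))) (δ-≢ (∉ (suc j) ≤-refl))

countRow≡0⇒∉ : ∀ T i j x → countRow T i j x ≡ 0 → ∀ j' → j' ≤ j → T i j' ≢ x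
countRow≡0⇒∉ T i zero x c≡0 .zero z≤n e = 0≢1+n (trans (sym c≡0) (δ-≡ e))
countRow≡0⇒∉ T i (suc j) x c≡0 j' j'≤1+j e with m≤n⇒m<n∨m≡n j'≤1+j
... | inj₁ j'<1+j = countRow≡0⇒∉ T i j x (m+n≡0⇒m≡0 _ c≡0) j' (≤-pred j'<1+j) e
... | inj₂ refl   = 0≢1+n (trans (sym (m+n≡0⇒n≡0 (countRow T i j x) c≡0)) (δ-≡ e))

countRow>0⇒∈ : ∀ T i j x → 0 < countRow T i j x → ∃[ j' ] j' ≤ j × T i j' ≡ x
countRow>0⇒∈ T i zero x c>0 = 0 , z≤n , δ>0⇒≡ c>0
countRow>0⇒∈ T i (suc j) x c>0 with T i (suc j) ≟ x
... | yes e = suc j , ≤-refl , e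
... | no  ne with countRow>0⇒∈ T i j x (subst (0 <_) (trans (cong (countRow T i j x +_) (δ-≢ ne)) (+-identityʳ _)) c>0)
...   | j' , j'≤j , e = j' , m≤n⇒m≤1+n j'≤j , e

countRow-cong : ∀ T T' i j x → (∀ j' → j' ≤ j → T' i j' ≡ T i j') →
  countRow T' i j x ≡ countRow T i j x
countRow-cong T T' i zero    x eq rewrite eq 0 z≤n = refl
countRow-cong T T' i (suc j) x eq
  rewrite countRow-cong T T' i j x (λ j' j'≤j → eq j' (m≤n⇒m≤1+n j'≤j)) | eq (suc j) ≤-refl = refl

countRow≤1 : ∀ {n T} → MonotoneTriangle n T → ∀ {i} j x → i < n → j ≤ i → countRow T i j x ≤ 1
countRow≤1 {T = T} mt zero x i<n _ = δ≤1 (T _ 0) x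
countRow≤1 {T = T} mt {i} (suc j) x i<n 1+j≤i with T i (suc j) ≟ x
... | no ne = ≤-trans (≤-reflexive (trans (cong (countRow T i j x +_) (δ-≢ ne)) (+-identityʳ _)))
                     (countRow≤1 mt j x i<n (≤-trans (n≤1+n j) 1+j≤i))
... | yes e = ≤-reflexive (cong₂ _+_ (countRow≡0 T i j x
                (λ j' j'≤j e' → <⇒≢ (row-< mt i<n (s≤s j'≤j) 1+j≤i) (trans e' (sym e)))) (δ-≡ e))

update : Array → ℕ → ℕ → ℕ → Array
update T i₀ j₀ c i j with i ≟ i₀ | j ≟ j₀
... | yes _ | yes _ = c
... | _     | _     = T i j

update-≡ : ∀ T i₀ j₀ c → update T i₀ j₀ c i₀ j₀ ≡ c
update-≡ T i₀ j₀ c with i₀ ≟ i₀ | j₀ ≟ j₀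
... | yes _ | yes _  = refl
... | no ne | _      = contradiction refl ne
... | yes _ | no ne  = contradiction refl ne

update-cases : ∀ T i₀ j₀ c i j → (i ≡ i₀ × j ≡ j₀) ⊎ update T i₀ j₀ c i j ≡ T i j
update-cases T i₀ j₀ c i j with i ≟ i₀ | j ≟ j₀
... | yes p | yes q = inj₁ (p , q)
... | yes _ | no _  = inj₂ refl
... | no _  | _     = inj₂ refl

EqualExcept : Array → Array → ℕ → ℕ → Set
EqualExcept T T' i₀ j₀ = ∀ i j → ¬ (i ≡ i₀ × j ≡ j₀) → T' i j ≡ T i j

update-equalExcept : ∀ T i₀ j₀ c → EqualExcept T (update T i₀ j₀ c) i₀ j₀
update-equalExcept T i₀ j₀ c i j ne with update-cases T i₀ j₀ c i j
... | inj₁ hit = contradiction hit ne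
... | inj₂ eq  = eq

countRow-update : ∀ {T T' i₀ j₀} x → EqualExcept T T' i₀ j₀ → ∀ j → j₀ ≤ j →
  countRow T' i₀ j x + δ (T i₀ j₀) x ≡ countRow T i₀ j x + δ (T' i₀ j₀) x
countRow-update {T} {T'} {i₀} x eq zero z≤n = +-comm (δ (T' i₀ 0) x) (δ (T i₀ 0) x)
countRow-update {T} {T'} {i₀} {j₀} x eq (suc j) j₀≤1+j with m≤n⇒m<n∨m≡n j₀≤1+j
... | inj₂ refl
  rewrite countRow-cong T T' i₀ j x (λ j' j'≤j → eq i₀ j' (λ (_ , e) → 1+n≰n (subst (_≤ j) e j'≤j)))
  = xy∙z≈xz∙y (countRow T i₀ j x) _ _
... | inj₁ j₀<1+j rewrite eq i₀ (suc j) (λ (_ , e) → <-irrefl (sym e) j₀<1+j) = begin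
  countRow T' i₀ j x + d + δ (T i₀ j₀) x  ≡⟨ xy∙z≈xz∙y (countRow T' i₀ j x) d _ ⟩
  countRow T' i₀ j x + δ (T i₀ j₀) x + d  ≡⟨ cong (_+ d) (countRow-update x eq j (≤-pred j₀<1+j)) ⟩
  countRow T i₀ j x + δ (T' i₀ j₀) x + d  ≡⟨ xy∙z≈xz∙y (countRow T i₀ j x) _ d ⟩
  countRow T i₀ j x + d + δ (T' i₀ j₀) x  ∎
  where
    open ≡-Reasoning
    d = δ (T i₀ (suc j)) x

occurrences-cong : ∀ T T' m x → (∀ i → i < m → ∀ j → T' i j ≡ T i j) →
  occurrences T' m x ≡ occurrences T m x
occurrences-cong T T' zero    x eq = refl
occurrences-cong T T' (suc m) x eq =
  cong₂ _+_ (occurrences-cong T T' m x (λ i i<m → eq i (m≤n⇒m≤1+n i<m)))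
            (countRow-cong T T' m m x (λ j _ → eq m ≤-refl j))

occurrences-update : ∀ {T T' i₀ j₀} x m → EqualExcept T T' i₀ j₀ → i₀ < m → j₀ ≤ i₀ →
  occurrences T' m x + δ (T i₀ j₀) x ≡ occurrences T m x + δ (T' i₀ j₀) x
occurrences-update {T} {T'} {i₀} {j₀} x (suc m) eq i₀<1+m j₀≤i₀ with m≤n⇒m<n∨m≡n (≤-pred i₀<1+m)
... | inj₁ i₀<m
  rewrite countRow-cong T T' m m x (λ j _ → eq m j (λ (e , _) → <-irrefl (sym e) i₀<m)) = begin
  occurrences T' m x + r + δ (T i₀ j₀) x  ≡⟨ xy∙z≈xz∙y (occurrences T' m x) r _ ⟩
  occurrences T' m x + δ (T i₀ j₀) x + r  ≡⟨ cong (_+ r) (occurrences-update x m eq i₀<m j₀≤i₀) ⟩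
  occurrences T m x + δ (T' i₀ j₀) x + r  ≡⟨ xy∙z≈xz∙y (occurrences T m x) _ r ⟩
  occurrences T m x + r + δ (T' i₀ j₀) x  ∎
  where
    open ≡-Reasoning
    r = countRow T m m x
... | inj₂ refl
  rewrite occurrences-cong T T' m x (λ i i<m j → eq i j (λ (e , _) → <-irrefl e i<m)) = begin
  occurrences T m x + countRow T' m m x + δ (T m j₀) x    ≡⟨ +-assoc (occurrences T m x) _ _ ⟩
  occurrences T m x + (countRow T' m m x + δ (T m j₀) x)
    ≡⟨ cong (occurrences T m x +_) (countRow-update x eq m j₀≤i₀) ⟩
  occurrences T m x + (countRow T m m x + δ (T' m j₀) x)  ≡⟨ +-assoc (occurrences T m x) _ _ ⟨
  occurrences T m x + countRow T m m x + δ (T' m j₀) x    ∎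
  where open ≡-Reasoning

-- Moving occurrences from k to k + 1

[m+n]∸[o+p]≤[m∸o]+[n∸p] : ∀ m n o p → (m + n) ∸ (o + p) ≤ (m ∸ o) + (n ∸ p)
[m+n]∸[o+p]≤[m∸o]+[n∸p] m n o p = m≤n+o⇒m∸n≤o (m + n) (o + p) (begin
  m + n                            ≤⟨ +-mono-≤ (m≤n+m∸n m o) (m≤n+m∸n n p) ⟩
  (o + (m ∸ o)) + (p + (n ∸ p))    ≡⟨ interchange o (m ∸ o) p (n ∸ p) ⟩
  (o + p) + ((m ∸ o) + (n ∸ p))    ∎)
  where open ≤-Reasoning

-- In a monotone triangle row m contains k at most once, so the summand is 1 exactly when
-- row m contains k but not k + 1.
lonelyRows : Array → ℕ → ℕ → ℕ
lonelyRows T zero    k = 0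
lonelyRows T (suc m) k = lonelyRows T m k + (countRow T m m k ∸ countRow T m m (suc k))

occurrences-∸-≤-lonelyRows : ∀ T m k → occurrences T m k ∸ occurrences T m (suc k) ≤ lonelyRows T m k
occurrences-∸-≤-lonelyRows T zero    k = z≤n
occurrences-∸-≤-lonelyRows T (suc m) k =
  ≤-trans ([m+n]∸[o+p]≤[m∸o]+[n∸p] (occurrences T m k) (countRow T m m k) (occurrences T m (suc k)) _)
          (+-monoˡ-≤ _ (occurrences-∸-≤-lonelyRows T m k))

lonelyRows-cong : ∀ T T' m k → (∀ i → i < m → ∀ j → T' i j ≡ T i j) → lonelyRows T' m k ≡ lonelyRows T m k
lonelyRows-cong T T' zero    k eq = refl
lonelyRows-cong T T' (suc m) k eq = cong₂ _+_
  (lonelyRows-cong T T' m k (λ i i<m → eq i (m≤n⇒m≤1+n i<m)))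
  (cong₂ _∸_ (countRow-cong T T' m m k (λ j _ → eq m ≤-refl j))
             (countRow-cong T T' m m (suc k) (λ j _ → eq m ≤-refl j)))

lonelyRows-update : ∀ {T T' i₀ j₀} k m → EqualExcept T T' i₀ j₀ → countRow T i₀ i₀ k ≤ 1 →
  lonelyRows T m k ≤ suc (lonelyRows T' m k)
lonelyRows-update k zero eq c≤1 = z≤n
lonelyRows-update {T} {T'} {i₀} k (suc m) eq c≤1 with m ≟ i₀
... | yes refl
  rewrite lonelyRows-cong T T' m k (λ i i<m j → eq i j (λ (e , _) → <-irrefl e i<m)) = begin
  lonelyRows T m k + (countRow T m m k ∸ countRow T m m (suc k))
    ≤⟨ +-monoʳ-≤ _ (≤-trans (m∸n≤m _ (countRow T m m (suc k))) c≤1) ⟩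
  lonelyRows T m k + 1                                            ≡⟨ +-comm _ 1 ⟩
  suc (lonelyRows T m k)                                          ≤⟨ s≤s (m≤m+n _ _) ⟩
  suc (lonelyRows T m k + (countRow T' m m k ∸ countRow T' m m (suc k))) ∎
  where open ≤-Reasoning
... | no m≢i₀
  rewrite countRow-cong T T' m m k (λ j _ → eq m j (λ (e , _) → m≢i₀ e))
        | countRow-cong T T' m m (suc k) (λ j _ → eq m j (λ (e , _) → m≢i₀ e)) =
  +-monoˡ-≤ (countRow T m m k ∸ countRow T m m (suc k)) (lonelyRows-update k m eq c≤1)

module _ {n : ℕ} {T : Array} (mt : MonotoneTriangle n T) where

  lonelyRows>0⇒lonelyRow : ∀ m k → m ≤ n → 0 < lonelyRows T m k →
    ∃[ i ] i < n × 0 < countRow T i i k × countRow T i i (suc k) ≡ 0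
  lonelyRows>0⇒lonelyRow (suc m) k 1+m≤n lonely>0 with countRow T m m k in eqₖ | countRow T m m (suc k) in eqₖ₊₁
  ... | 1 | 0 = m , 1+m≤n , ≤-reflexive (sym eqₖ) , eqₖ₊₁
  ... | 0 | c = lonelyRows>0⇒lonelyRow m k (≤-trans (n≤1+n m) 1+m≤n)
                  (subst (0 <_) (trans (cong (lonelyRows T m k +_) (0∸n≡0 c)) (+-identityʳ _)) lonely>0)
  ... | 1 | suc c = lonelyRows>0⇒lonelyRow m k (≤-trans (n≤1+n m) 1+m≤n)
                      (subst (0 <_) (trans (cong (lonelyRows T m k +_) (0∸n≡0 c)) (+-identityʳ _)) lonely>0)
  ... | suc (suc _) | _ = contradiction (subst (_≤ 1) eqₖ (countRow≤1 mt m k 1+m≤n ≤-refl)) λ { (s≤s ()) }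

record Moved (n k m : ℕ) (T T' : Array) : Set where
  constructor moved
  field occurrences-moved : ∀ z → occurrences T' n z + m * δ k z ≡ occurrences T n z + m * δ (suc k) z

Moved-trans : ∀ {n k a b T T₁ T₂} → Moved n k a T T₁ → Moved n k b T₁ T₂ → Moved n k (a + b) T T₂
Moved-trans {n} {k} {a} {b} {T} {T₁} {T₂} (moved T→T₁) (moved T₁→T₂) = moved composed
  where
    composed : ∀ z → occurrences T₂ n z + (a + b) * δ k z ≡ occurrences T n z + (a + b) * δ (suc k) z
    composed z = begin
      o T₂ + (a + b) * p      ≡⟨ cong (o T₂ +_) (trans (*-distribʳ-+ p a b) (+-comm (a * p) (b * p))) ⟩
      o T₂ + (b * p + a * p)  ≡⟨ +-assoc (o T₂) _ _ ⟨
      o T₂ + b * p + a * p    ≡⟨ cong (_+ a * p) (T₁→T₂ z) ⟩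
      o T₁ + b * q + a * p    ≡⟨ xy∙z≈xz∙y (o T₁) _ _ ⟩
      o T₁ + a * p + b * q    ≡⟨ cong (_+ b * q) (T→T₁ z) ⟩
      o T + a * q + b * q     ≡⟨ +-assoc (o T) _ _ ⟩
      o T + (a * q + b * q)   ≡⟨ cong (o T +_) (*-distribʳ-+ q a b) ⟨
      o T + (a + b) * q       ∎
      where
        open ≡-Reasoning
        o = λ T → occurrences T n z
        p = δ k z
        q = δ (suc k) z

Moved-k : ∀ {n k m T T'} → Moved n k m T T' → occurrences T' n k + m ≡ occurrences T n k
Moved-k {n} {k} {m} {T} {T'} (moved eq) with eq k
... | e rewrite δ-≡ {k} refl | δ-≢ {suc k} {k} 1+n≢n | *-identityʳ m | *-zeroʳ m | +-identityʳ (occurrences T n k) = e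

Moved-suc-k : ∀ {n k m T T'} → Moved n k m T T' → occurrences T' n (suc k) ≡ occurrences T n (suc k) + m
Moved-suc-k {n} {k} {m} {T} {T'} (moved eq) with eq (suc k)
... | e rewrite δ-≢ {k} {suc k} (≢-sym 1+n≢n) | δ-≡ {suc k} refl | *-identityʳ m | *-zeroʳ m
              | +-identityʳ (occurrences T' n (suc k)) = e

Moved-other : ∀ {n k m T T'} → Moved n k m T T' → ∀ z → z ≢ k → z ≢ suc k →
  occurrences T' n z ≡ occurrences T n z
Moved-other {n} {k} {m} {T} {T'} (moved eq) z z≢k z≢1+k with eq z
... | e rewrite δ-≢ (≢-sym z≢k) | δ-≢ (≢-sym z≢1+k) | *-zeroʳ m = +-cancelʳ-≡ 0 _ _ e

module Flip {n : ℕ} {T : Array} (mt : MonotoneTriangle n T) (k : ℕ) (1+k≤n : suc k ≤ n) where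
  open MonotoneTriangle mt

  LonelyK : ℕ → ℕ → Set
  LonelyK i j = i < n × j ≤ i × T i j ≡ k × (∀ j' → j' ≤ i → T i j' ≢ suc k)

  -- Along the diagonals, (i, j) is bounded from above by (i + 1, j + 1) and (i − 1, j).
  NoKBelow : ℕ → ℕ → Set
  NoKBelow i j = suc i < n → T (suc i) (suc j) ≢ k

  NoKAbove : ℕ → ℕ → Set
  NoKAbove zero    j = ⊤
  NoKAbove (suc i) j = j ≤ i → T i j ≢ k

  Flippable : ℕ → ℕ → Set
  Flippable i j = LonelyK i j × NoKBelow i j × NoKAbove i j

  mkLonelyK : ∀ {i j} → i < n → j ≤ i → T i j ≡ k → (suc j ≤ i → suc (suc k) ≤ T i (suc j)) → LonelyK i j
  mkLonelyK {i} {j} i<n j≤i Tij≡k right = i<n , j≤i , Tij≡k , noSucK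
    where
      noSucK : ∀ j' → j' ≤ i → T i j' ≢ suc k
      noSucK j' j'≤i with <-cmp j' j
      ... | tri< j'<j _ _ = <⇒≢ (<-≤-trans (row-< mt i<n j'<j j≤i) (≤-trans (≤-reflexive Tij≡k) (n≤1+n k)))
      ... | tri≈ _ refl _ = λ e → 1+n≢n (trans (sym e) Tij≡k)
      ... | tri> _ _ j<j' = >⇒≢ (≤-trans (right (≤-trans j<j' j'≤i)) (row-≤ mt i<n j<j' j'≤i))

  k+2≤right : ∀ {i j} → LonelyK i j → suc j ≤ i → suc (suc k) ≤ T i (suc j)
  k+2≤right {i} {j} (i<n , _ , Tij≡k , noSucK) 1+j≤i =
    ≤∧≢⇒< (subst (_< T i (suc j)) Tij≡k (row-strict i j i<n 1+j≤i)) (λ e → noSucK (suc j) 1+j≤i (sym e))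

  lonely-down : ∀ {i j} → LonelyK i j → suc i < n → T (suc i) (suc j) ≡ k → LonelyK (suc i) (suc j)
  lonely-down {i} {j} L@(_ , j≤i , _) 1+i<n ≡k = mkLonelyK 1+i<n (s≤s j≤i) ≡k λ 2+j≤1+i →
    ≤-trans (k+2≤right L (≤-pred 2+j≤1+i)) (se-diag i (suc j) 1+i<n (≤-pred 2+j≤1+i))

  lonely-up : ∀ {i j} → LonelyK (suc i) j → j ≤ i → T i j ≡ k → LonelyK i j × NoKBelow i j
  lonely-up {i} {j} L@(1+i<n , _ , T1+ij≡k , _) j≤i ≡k =
    mkLonelyK (<-trans (n<1+n i) 1+i<n) j≤i ≡k
      (λ 1+j≤i → ≤-trans (k+2≤right L (s≤s j≤i)) (ne-diag i (suc j) 1+i<n 1+j≤i)) ,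
    λ _ e → <-irrefl (trans T1+ij≡k (sym e)) (row-strict (suc i) j 1+i<n (s≤s j≤i))

  descend : ∀ d {i j} → d + i ≡ n → LonelyK i j → ∃[ i' ] ∃[ j' ] LonelyK i' j' × NoKBelow i' j'
  descend zero refl (i<n , _) = contradiction i<n (<-irrefl refl)
  descend (suc d) {i} {j} d+i≡n L with suc i <? n
  ... | no  1+i≮n = i , j , L , λ 1+i<n → contradiction 1+i<n 1+i≮n
  ... | yes 1+i<n with T (suc i) (suc j) ≟ k
  ...   | no  ≢k = i , j , L , λ _ → ≢k
  ...   | yes ≡k = descend d (trans (+-suc d i) d+i≡n) (lonely-down L 1+i<n ≡k)

  ascend : ∀ {i j} → LonelyK i j → NoKBelow i j → ∃[ i' ] ∃[ j' ] Flippable i' j'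
  ascend {zero}  {j} L noBelow = 0 , j , L , noBelow , tt
  ascend {suc i} {j} L noBelow with j ≤? i
  ... | no  j≰i = suc i , j , L , noBelow , λ j≤i → contradiction j≤i j≰i
  ... | yes j≤i with T i j ≟ k
  ...   | no  ≢k = suc i , j , L , noBelow , λ _ → ≢k
  ...   | yes ≡k = let (L' , noBelow') = lonely-up L j≤i ≡k in ascend L' noBelow'

  flippable : ∀ {i j} → LonelyK i j → ∃[ i' ] ∃[ j' ] Flippable i' j'
  flippable {i} L@(i<n , _) =
    let (_ , _ , L' , noBelow) = descend (n ∸ i) (m∸n+n≡m (<⇒≤ i<n)) L in ascend L' noBelow

  flip-monotone : ∀ {i₀ j₀} → Flippable i₀ j₀ → MonotoneTriangle n (update T i₀ j₀ (suc k))
  flip-monotone {i₀} {j₀} (L@(_ , _ , T≡k , _) , noBelow , noAbove) = record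
    { entry-≥1 = ≥1 ; entry-≤n = ≤n ; row-strict = strict ; ne-diag = ne ; se-diag = se }
    where
      T' = update T i₀ j₀ (suc k)
      at = update-cases T i₀ j₀ (suc k)
      new = update-≡ T i₀ j₀ (suc k)

      ≥1 : ∀ i j → i < n → j ≤ i → 1 ≤ T' i j
      ≥1 i j i<n j≤i with at i j
      ... | inj₁ (refl , refl) rewrite new = s≤s z≤n
      ... | inj₂ old rewrite old = entry-≥1 i j i<n j≤i

      ≤n : ∀ i j → i < n → j ≤ i → T' i j ≤ n
      ≤n i j i<n j≤i with at i j
      ... | inj₁ (refl , refl) rewrite new = 1+k≤n
      ... | inj₂ old rewrite old = entry-≤n i j i<n j≤i

      strict : ∀ i j → i < n → suc j ≤ i → T' i j < T' i (suc j)
      strict i j i<n 1+j≤i with at i j | at i (suc j)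
      ... | inj₁ (refl , refl) | inj₁ (_ , ())
      ... | inj₁ (refl , refl) | inj₂ old rewrite new | old = k+2≤right L 1+j≤i
      ... | inj₂ old | inj₁ (refl , refl) rewrite new | old =
            s≤s (≤-trans (<⇒≤ (row-strict i j i<n 1+j≤i)) (≤-reflexive T≡k))
      ... | inj₂ old | inj₂ old' rewrite old | old' = row-strict i j i<n 1+j≤i

      ne : ∀ i j → suc i < n → j ≤ i → T' (suc i) j ≤ T' i j
      ne i j 1+i<n j≤i with at (suc i) j | at i j
      ... | inj₁ (refl , refl) | inj₁ (e , _) = contradiction (sym e) 1+n≢n
      ... | inj₁ (refl , refl) | inj₂ old rewrite new | old =
            ≤∧≢⇒< (subst (_≤ T i j) T≡k (ne-diag i j 1+i<n j≤i)) (λ e → noAbove j≤i (sym e))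
      ... | inj₂ old | inj₁ (refl , refl) rewrite new | old =
            ≤-trans (subst (T (suc i) j ≤_) T≡k (ne-diag i j 1+i<n j≤i)) (n≤1+n k)
      ... | inj₂ old | inj₂ old' rewrite old | old' = ne-diag i j 1+i<n j≤i

      se : ∀ i j → suc i < n → j ≤ i → T' i j ≤ T' (suc i) (suc j)
      se i j 1+i<n j≤i with at i j | at (suc i) (suc j)
      ... | inj₁ (refl , refl) | inj₁ (e , _) = contradiction e 1+n≢n
      ... | inj₁ (refl , refl) | inj₂ old rewrite new | old =
            ≤∧≢⇒< (subst (_≤ T (suc i) (suc j)) T≡k (se-diag i j 1+i<n j≤i)) (λ e → noBelow 1+i<n (sym e))
      ... | inj₂ old | inj₁ (refl , refl) rewrite new | old =
            ≤-trans (subst (T i j ≤_) T≡k (se-diag i j 1+i<n j≤i)) (n≤1+n k)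
      ... | inj₂ old | inj₂ old' rewrite old | old' = se-diag i j 1+i<n j≤i

  flip-lonely : 0 < lonelyRows T n k →
    ∃[ T' ] MonotoneTriangle n T' × Moved n k 1 T T' × lonelyRows T n k ≤ suc (lonelyRows T' n k)
  flip-lonely lonely>0 with lonelyRows>0⇒lonelyRow mt n k ≤-refl lonely>0
  ... | i , i<n , hasK , noSucK with countRow>0⇒∈ T i i k hasK
  ... | j , j≤i , Tij≡k
      with flippable (i<n , j≤i , Tij≡k , countRow≡0⇒∉ T i i (suc k) noSucK)
  ... | i₀ , j₀ , F@((i₀<n , j₀≤i₀ , T≡k , _) , _) =
    T' , flip-monotone F , moved 1-moved ,
    lonelyRows-update k n (update-equalExcept T i₀ j₀ (suc k)) (countRow≤1 mt i₀ k i₀<n ≤-refl)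
    where
      T' = update T i₀ j₀ (suc k)
      1-moved : ∀ z → occurrences T' n z + 1 * δ k z ≡ occurrences T n z + 1 * δ (suc k) z
      1-moved z = begin
        occurrences T' n z + 1 * δ k z          ≡⟨ cong (occurrences T' n z +_) (*-identityˡ _) ⟩
        occurrences T' n z + δ k z              ≡⟨ cong (λ a → occurrences T' n z + δ a z) T≡k ⟨
        occurrences T' n z + δ (T i₀ j₀) z
          ≡⟨ occurrences-update z n (update-equalExcept T i₀ j₀ (suc k)) i₀<n j₀≤i₀ ⟩
        occurrences T n z + δ (T' i₀ j₀) z      ≡⟨ cong (λ a → occurrences T n z + δ a z) (update-≡ T i₀ j₀ (suc k)) ⟩
        occurrences T n z + δ (suc k) z         ≡⟨ cong (occurrences T n z +_) (*-identityˡ _) ⟨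
        occurrences T n z + 1 * δ (suc k) z     ∎
        where open ≡-Reasoning

transfer : ∀ {n k} → suc k ≤ n → ∀ m {T} → MonotoneTriangle n T → m ≤ lonelyRows T n k →
  ∃[ T' ] MonotoneTriangle n T' × Moved n k m T T'
transfer 1+k≤n zero    {T} mt _ = T , mt , moved λ _ → refl
transfer 1+k≤n (suc m) mt 1+m≤lonely with Flip.flip-lonely mt _ 1+k≤n (≤-trans (s≤s z≤n) 1+m≤lonely)
... | T₁ , mt₁ , T→T₁ , lonely≤ with transfer 1+k≤n m mt₁ (≤-pred (≤-trans 1+m≤lonely lonely≤))
...   | T₂ , mt₂ , T₁→T₂ = T₂ , mt₂ , Moved-trans T→T₁ T₁→T₂

-- Counting values in a window

-- As pred 0 = 0, a window reaching below 0 repeats c 0.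
sumDown : (ℕ → ℕ) → ℕ → ℕ → ℕ
sumDown c s zero    = 0
sumDown c s (suc k) = c s + sumDown c (pred s) k

sumBelow : (ℕ → ℕ) → ℕ → ℕ
sumBelow a zero    = 0
sumBelow a (suc m) = sumBelow a m + a m

sumDown-+ : ∀ f g s k → sumDown (λ z → f z + g z) s k ≡ sumDown f s k + sumDown g s k
sumDown-+ f g s zero    = refl
sumDown-+ f g s (suc k) =
  trans (cong (f s + g s +_) (sumDown-+ f g (pred s) k)) (interchange (f s) (g s) _ _)

sumDown-occurrences : ∀ T m s k →
  sumDown (occurrences T m) s k ≡ sumBelow (λ i → sumDown (countRow T i i) s k) m
sumDown-occurrences T zero    s zero    = refl
sumDown-occurrences T zero    s (suc k) = sumDown-occurrences T zero (pred s) k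
sumDown-occurrences T (suc m) s k =
  trans (sumDown-+ (occurrences T m) (countRow T m m) s k)
        (cong (_+ sumDown (countRow T m m) s k) (sumDown-occurrences T m s k))

sumDown≤k : ∀ c s k → (∀ z → c z ≤ 1) → sumDown c s k ≤ k
sumDown≤k c s zero    c≤1 = z≤n
sumDown≤k c s (suc k) c≤1 = +-mono-≤ (c≤1 s) (sumDown≤k c (pred s) k c≤1)

sumDown-δ-below : ∀ t s k → s < t → sumDown (δ t) s k ≡ 0
sumDown-δ-below t s zero    _   = refl
sumDown-δ-below t s (suc k) s<t rewrite δ-≢ {t} {s} (>⇒≢ s<t) =
  sumDown-δ-below t (pred s) k (≤-<-trans (pred[n]≤n {s}) s<t)

sumDown-δ≤1 : ∀ t s k → k ≤ suc s → sumDown (δ t) s k ≤ 1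
sumDown-δ≤1 t s       zero          _           = z≤n
sumDown-δ≤1 t zero    (suc zero)    _           = subst (_≤ 1) (sym (+-identityʳ (δ t 0))) (δ≤1 t 0)
sumDown-δ≤1 t zero    (suc (suc k)) (s≤s ())
sumDown-δ≤1 t (suc s) (suc k)       (s≤s k≤1+s) with t ≟ suc s
... | yes refl = ≤-reflexive (cong₂ _+_ (δ-≡ {suc s} refl) (sumDown-δ-below (suc s) s k (n<1+n s)))
... | no  t≢1+s rewrite δ-≢ t≢1+s = sumDown-δ≤1 t s k k≤1+s

sumDown-δ-full : ∀ t s → 1 ≤ t → t ≤ s → sumDown (δ t) s s ≡ 1
sumDown-δ-full t zero    1≤t t≤0 = contradiction (≤-trans 1≤t t≤0) λ ()
sumDown-δ-full t (suc s) 1≤t t≤1+s with t ≟ suc s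
... | yes refl = cong₂ _+_ (δ-≡ {suc s} refl) (sumDown-δ-below (suc s) s s (n<1+n s))
... | no  t≢1+s rewrite δ-≢ t≢1+s = sumDown-δ-full t s 1≤t (≤-pred (≤∧≢⇒< t≤1+s t≢1+s))

sumDown-countRow≤ : ∀ T i j s k → k ≤ suc s → sumDown (countRow T i j) s k ≤ suc j
sumDown-countRow≤ T i zero    s k k≤1+s = sumDown-δ≤1 (T i 0) s k k≤1+s
sumDown-countRow≤ T i (suc j) s k k≤1+s rewrite sumDown-+ (countRow T i j) (δ (T i (suc j))) s k =
  ≤-trans (+-mono-≤ (sumDown-countRow≤ T i j s k k≤1+s) (sumDown-δ≤1 (T i (suc j)) s k k≤1+s))
          (≤-reflexive (+-comm (suc j) 1))

sumDown-id-suc : ∀ k n → k ≤ suc n → sumDown id (suc n) k ≡ sumDown id n k + k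
sumDown-id-suc zero    n       _ = refl
sumDown-id-suc (suc k) zero    (s≤s z≤n) = refl
sumDown-id-suc (suc k) (suc n) (s≤s k≤1+n) rewrite sumDown-id-suc k n k≤1+n =
  cong suc (trans (cong suc (sym (+-assoc n (sumDown id n k) k))) (sym (+-suc (n + sumDown id n k) k)))

sumBelow-≤-staircase : ∀ m k a → k ≤ m → (∀ i → i < m → a i ≤ k) → (∀ i → i < m → a i ≤ suc i) →
  sumBelow a m ≤ sumDown id m k
sumBelow-≤-staircase zero    zero a _ _ _ = z≤n
sumBelow-≤-staircase (suc m) k a k≤1+m ≤k ≤1+i with m≤n⇒m<n∨m≡n k≤1+m
... | inj₁ k<1+m = ≤-trans (+-mono-≤
        (sumBelow-≤-staircase m k a (≤-pred k<1+m) (λ i i<m → ≤k i (m≤n⇒m≤1+n i<m)) (λ i i<m → ≤1+i i (m≤n⇒m≤1+n i<m)))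
        (≤k m ≤-refl)) (≤-reflexive (sym (sumDown-id-suc k m k≤1+m)))
... | inj₂ refl = ≤-trans (+-mono-≤
        (sumBelow-≤-staircase m m a ≤-refl (λ i i<m → ≤-trans (≤1+i i (m≤n⇒m≤1+n i<m)) i<m)
                                           (λ i i<m → ≤1+i i (m≤n⇒m≤1+n i<m)))
        (≤1+i m ≤-refl)) (≤-reflexive (+-comm (sumDown id m m) (suc m)))

sumBelow-staircase : ∀ m a → (∀ i → i < m → a i ≡ suc i) → sumBelow a m ≡ sumDown id m m
sumBelow-staircase zero    a _ = refl
sumBelow-staircase (suc m) a a≡1+i
  rewrite sumBelow-staircase m a (λ i i<m → a≡1+i i (m≤n⇒m≤1+n i<m)) | a≡1+i m ≤-refl = +-comm (sumDown id m m) (suc m)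

module _ {n : ℕ} {T : Array} (mt : MonotoneTriangle n T) where
  open MonotoneTriangle mt

  -- Row i has at most min(k, i + 1) entries among any k consecutive values.
  sumDown-occurrences≤ : ∀ k → k ≤ n → sumDown (occurrences T n) n k ≤ sumDown id n k
  sumDown-occurrences≤ k k≤n rewrite sumDown-occurrences T n n k = sumBelow-≤-staircase n k _ k≤n
    (λ i i<n → sumDown≤k (countRow T i i) n k (λ z → countRow≤1 mt i z i<n ≤-refl))
    (λ i i<n → sumDown-countRow≤ T i i n k (≤-trans k≤n (n≤1+n n)))

  sumDown-countRow-full : ∀ i j → i < n → j ≤ i → sumDown (countRow T i j) n n ≡ suc j
  sumDown-countRow-full i zero    i<n _ = sumDown-δ-full (T i 0) n (entry-≥1 i 0 i<n z≤n) (entry-≤n i 0 i<n z≤n)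
  sumDown-countRow-full i (suc j) i<n 1+j≤i
    rewrite sumDown-+ (countRow T i j) (δ (T i (suc j))) n n
          | sumDown-countRow-full i j i<n (≤-trans (n≤1+n j) 1+j≤i)
          | sumDown-δ-full (T i (suc j)) n (entry-≥1 i (suc j) i<n 1+j≤i) (entry-≤n i (suc j) i<n 1+j≤i) =
    +-comm (suc j) 1

  sumDown-occurrences-total : sumDown (occurrences T n) n n ≡ sumDown id n n
  sumDown-occurrences-total rewrite sumDown-occurrences T n n n =
    sumBelow-staircase n _ (λ i i<n → sumDown-countRow-full i i i<n ≤-refl)

-- Occurrence vectors

liftTriangle : Array → Array
liftTriangle T zero    j       = 1
liftTriangle T (suc i) zero    = 1
liftTriangle T (suc i) (suc j) = suc (T i j)

liftTriangle-monotone : ∀ {m T} → MonotoneTriangle m T → MonotoneTriangle (suc m) (liftTriangle T)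
liftTriangle-monotone {m} {T} mt = record
  { entry-≥1 = ≥1 ; entry-≤n = ≤n ; row-strict = strict ; ne-diag = ne ; se-diag = se }
  where
    open MonotoneTriangle mt
    ≥1 : ∀ i j → i < suc m → j ≤ i → 1 ≤ liftTriangle T i j
    ≥1 zero    j       _ _ = s≤s z≤n
    ≥1 (suc i) zero    _ _ = s≤s z≤n
    ≥1 (suc i) (suc j) _ _ = s≤s z≤n
    ≤n : ∀ i j → i < suc m → j ≤ i → liftTriangle T i j ≤ suc m
    ≤n zero    j       _ _ = s≤s z≤n
    ≤n (suc i) zero    _ _ = s≤s z≤n
    ≤n (suc i) (suc j) (s≤s i<m) (s≤s j≤i) = s≤s (entry-≤n i j i<m j≤i)
    strict : ∀ i j → i < suc m → suc j ≤ i → liftTriangle T i j < liftTriangle T i (suc j)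
    strict (suc i) zero    (s≤s i<m) (s≤s j≤i) = s≤s (entry-≥1 i 0 i<m z≤n)
    strict (suc i) (suc j) (s≤s i<m) (s≤s 1+j≤i) = s≤s (row-strict i j i<m 1+j≤i)
    ne : ∀ i j → suc i < suc m → j ≤ i → liftTriangle T (suc i) j ≤ liftTriangle T i j
    ne zero    zero    _ _ = ≤-refl
    ne (suc i) zero    _ _ = ≤-refl
    ne (suc i) (suc j) (s≤s 1+i<m) (s≤s j≤i) = s≤s (ne-diag i j 1+i<m j≤i)
    se : ∀ i j → suc i < suc m → j ≤ i → liftTriangle T i j ≤ liftTriangle T (suc i) (suc j)
    se zero    zero    _ _ = s≤s z≤n
    se (suc i) zero    _ _ = s≤s z≤n
    se (suc i) (suc j) (s≤s 1+i<m) (s≤s j≤i) = s≤s (se-diag i j 1+i<m j≤i)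

countRow-lift : ∀ T i j x → countRow (liftTriangle T) (suc i) (suc j) (suc x) ≡ δ 1 (suc x) + countRow T i j x
countRow-lift T i zero    x = refl
countRow-lift T i (suc j) x = trans (cong (_+ δ (T i (suc j)) x) (countRow-lift T i j x)) (+-assoc (δ 1 (suc x)) _ _)

module _ {m : ℕ} {T : Array} (mt : MonotoneTriangle m T) where
  open MonotoneTriangle mt

  occurrences-lift-1 : ∀ i → i ≤ m → occurrences (liftTriangle T) (suc i) 1 ≡ suc i
  occurrences-lift-1 zero    _     = refl
  occurrences-lift-1 (suc i) 1+i≤m
    rewrite occurrences-lift-1 i (≤-trans (n≤1+n i) 1+i≤m) | countRow-lift T i i 0
          | countRow≡0 T i i 0 (λ j j≤i e → 1+n≰n (subst (1 ≤_) e (entry-≥1 i j 1+i≤m j≤i))) = +-comm (suc i) 1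

occurrences-lift-suc : ∀ T i y → occurrences (liftTriangle T) (suc i) (suc (suc y)) ≡ occurrences T i (suc y)
occurrences-lift-suc T zero    y = refl
occurrences-lift-suc T (suc i) y rewrite occurrences-lift-suc T i y | countRow-lift T i i (suc y) = refl

Enumerates : (ℕ → ℕ) → ℕ → List ℕ → Set
Enumerates c s []       = ⊤
Enumerates c s (x ∷ xs) = c s ≡ x × Enumerates c (suc s) xs

Enumerates-cong : ∀ {c c'} s xs → (∀ z → s ≤ z → z < length xs + s → c' z ≡ c z) →
  Enumerates c s xs → Enumerates c' s xs
Enumerates-cong s []       eq _         = tt
Enumerates-cong s (x ∷ xs) eq (e , E) = trans (eq s ≤-refl (s≤s (m≤n+m s _))) e ,
  Enumerates-cong (suc s) xs (λ z 1+s≤z z<|xs|+1+s → eq z (≤-trans (n≤1+n s) 1+s≤z) (subst (z <_) (+-suc _ s) z<|xs|+1+s)) E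

Enumerates-++⁻ : ∀ c s xs ys → Enumerates c s (xs ++ ys) → Enumerates c s xs × Enumerates c (length xs + s) ys
Enumerates-++⁻ c s []       ys E       = tt , E
Enumerates-++⁻ c s (x ∷ xs) ys (e , E) with Enumerates-++⁻ c (suc s) xs ys E
... | Exs , Eys = (e , Exs) , subst (λ t → Enumerates c t ys) (+-suc (length xs) s) Eys

Enumerates-++⁺ : ∀ c s xs ys → Enumerates c s xs → Enumerates c (length xs + s) ys → Enumerates c s (xs ++ ys)
Enumerates-++⁺ c s []       ys _         Eys = Eys
Enumerates-++⁺ c s (x ∷ xs) ys (e , Exs) Eys =
  e , Enumerates-++⁺ c (suc s) xs ys Exs (subst (λ t → Enumerates c t ys) (sym (+-suc (length xs) s)) Eys)

Enumerates-shift : ∀ c c' s xs → (∀ z → s ≤ z → c' (suc z) ≡ c z) → Enumerates c s xs → Enumerates c' (suc s) xs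
Enumerates-shift c c' s []       eq _       = tt
Enumerates-shift c c' s (x ∷ xs) eq (e , E) =
  trans (eq s ≤-refl) e , Enumerates-shift c c' (suc s) xs (λ z 1+s≤z → eq z (≤-trans (n≤1+n s) 1+s≤z)) E

EnumeratesDown : (ℕ → ℕ) → ℕ → List ℕ → Set
EnumeratesDown c s []       = ⊤
EnumeratesDown c s (x ∷ xs) = c s ≡ x × EnumeratesDown c (pred s) xs

EnumeratesDown-reverseAcc : ∀ c s acc xs → EnumeratesDown c s acc → Enumerates c (suc s) xs →
  EnumeratesDown c (s + length xs) (reverseAcc acc xs)
EnumeratesDown-reverseAcc c s acc []       D _       = subst (λ t → EnumeratesDown c t acc) (sym (+-identityʳ s)) D
EnumeratesDown-reverseAcc c s acc (x ∷ xs) D (e , E) =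
  subst (λ t → EnumeratesDown c t (reverseAcc (x ∷ acc) xs)) (sym (+-suc s (length xs)))
    (EnumeratesDown-reverseAcc c (suc s) (x ∷ acc) xs (e , D) E)

EnumeratesDown-sum-take : ∀ c s xs k → EnumeratesDown c s xs → k ≤ length xs → sum (take k xs) ≡ sumDown c s k
EnumeratesDown-sum-take c s xs       zero    _       _         = refl
EnumeratesDown-sum-take c s (x ∷ xs) (suc k) (e , D) (s≤s k≤) =
  cong₂ _+_ (sym e) (EnumeratesDown-sum-take c (pred s) xs k D k≤)

Enumerates-tabulate⁺ : ∀ c s {m} (v : Fin m → ℕ) → (∀ k → c (s + toℕ k) ≡ v k) → Enumerates c s (tabulate v)
Enumerates-tabulate⁺ c s {zero}  v eq = tt
Enumerates-tabulate⁺ c s {suc m} v eq = trans (cong c (sym (+-identityʳ s))) (eq zero) ,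
  Enumerates-tabulate⁺ c (suc s) (v ∘ suc) (λ k → trans (cong c (sym (+-suc s (toℕ k)))) (eq (suc k)))

Enumerates-tabulate⁻ : ∀ c s {m} (v : Fin m → ℕ) → Enumerates c s (tabulate v) → ∀ k → c (s + toℕ k) ≡ v k
Enumerates-tabulate⁻ c s v (e , _) zero    = trans (cong c (+-identityʳ s)) e
Enumerates-tabulate⁻ c s v (_ , E) (suc k) =
  trans (cong c (+-suc s (toℕ k))) (Enumerates-tabulate⁻ c (suc s) (v ∘ suc) E k)

Realizable : ℕ → List ℕ → Set
Realizable n xs = length xs ≡ n × ∃[ T ] MonotoneTriangle n T × Enumerates (occurrences T n) 1 xs

length-prefix+2≤ : ∀ {n} pre (x y : ℕ) qs → length (pre ++ x ∷ y ∷ qs) ≡ n → suc (length pre + 1) ≤ n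
length-prefix+2≤ {n} pre x y qs len = begin
  suc (length pre + 1)               ≡⟨ +-suc (length pre) 1 ⟨
  length pre + 2                     ≤⟨ +-monoʳ-≤ (length pre) (m≤m+n 2 (length qs)) ⟩
  length pre + length (x ∷ y ∷ qs)   ≡⟨ length-++ pre ⟨
  length (pre ++ x ∷ y ∷ qs)         ≡⟨ len ⟩
  n                                  ∎
  where open ≤-Reasoning

-- x and y count the values k = length pre + 1 and k + 1.
realizable-transfer : ∀ {n} pre x y qs m → m ≤ x ∸ y →
  Realizable n (pre ++ x ∷ y ∷ qs) → Realizable n (pre ++ (x ∸ m) ∷ (y + m) ∷ qs)
realizable-transfer {n} pre x y qs m m≤x∸y (len , T , mt , E)
  with Enumerates-++⁻ (occurrences T n) 1 pre (x ∷ y ∷ qs) E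
... | Epre , cₖ≡x , cₖ₊₁≡y , Eqs
  with transfer (length-prefix+2≤ pre x y qs len) m mt
         (≤-trans m≤x∸y (subst₂ (λ a b → a ∸ b ≤ lonelyRows T n (length pre + 1)) cₖ≡x cₖ₊₁≡y
                                (occurrences-∸-≤-lonelyRows T n (length pre + 1))))
... | T' , mt' , mv = trans (length-++ pre) (trans (sym (length-++ pre)) len) , T' , mt' ,
  Enumerates-++⁺ c' 1 pre _
    (Enumerates-cong 1 pre (λ z _ z<k → Moved-other mv z (<⇒≢ z<k) (<⇒≢ (<-trans z<k (n<1+n k)))) Epre)
    ( trans (sym (m+n∸n≡m (c' k) m)) (cong (_∸ m) (trans (Moved-k mv) cₖ≡x))
    , trans (Moved-suc-k mv) (cong (_+ m) cₖ₊₁≡y)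
    , Enumerates-cong (suc (suc k)) qs (λ z 2+k≤z _ → Moved-other mv z
        (>⇒≢ (<-trans (n<1+n k) 2+k≤z)) (>⇒≢ 2+k≤z)) Eqs)
  where
    k = length pre + 1
    c' = occurrences T' n

realizable-swap : ∀ {n} pre x y qs → y ≤ x → Realizable n (pre ++ x ∷ y ∷ qs) → Realizable n (pre ++ y ∷ x ∷ qs)
realizable-swap {n} pre x y qs y≤x R =
  subst₂ (λ u w → Realizable n (pre ++ u ∷ w ∷ qs)) (m∸[m∸n]≡n y≤x) (m+[n∸m]≡n y≤x)
    (realizable-transfer pre x y qs (x ∸ y) ≤-refl R)

realizable-carry : ∀ {n} pre x y qs → y ≤ x →
  Realizable n (pre ++ suc x ∷ y ∷ qs) → Realizable n (pre ++ x ∷ suc y ∷ qs)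
realizable-carry {n} pre x y qs y≤x R =
  subst (λ w → Realizable n (pre ++ x ∷ w ∷ qs)) (+-comm y 1)
    (realizable-transfer pre (suc x) y qs 1 (subst (1 ≤_) (sym (+-∸-assoc 1 y≤x)) (s≤s z≤n)) R)

realizable-[] : Realizable 0 []
realizable-[] = refl , (λ _ _ → 0) , record
  { entry-≥1 = λ _ _ () ; entry-≤n = λ _ _ () ; row-strict = λ _ _ () ; ne-diag = λ _ _ () ; se-diag = λ _ _ () } , tt

realizable-lift : ∀ m w → Realizable m w → Realizable (suc m) (suc m ∷ w)
realizable-lift m w (len , T , mt , E) =
  cong suc len , liftTriangle T , liftTriangle-monotone mt , occurrences-lift-1 mt m ≤-refl ,
  Enumerates-shift (occurrences T m) (occurrences (liftTriangle T) (suc m)) 1 w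
    (λ { (suc y) _ → occurrences-lift-suc T m y }) E

-- Sorting occurrence vectors

module _ {a ℓ} {A : Set a} {R : A → A → Set ℓ} where

  Linked-reverseAcc : ∀ {acc} xs → Linked (flip R) acc → Linked R xs →
    Connected (flip R) (head xs) (head acc) → Linked (flip R) (reverseAcc acc xs)
  Linked-reverseAcc []       Racc _   _ = Racc
  Linked-reverseAcc (x ∷ xs) Racc Rxs c =
    Linked-reverseAcc xs (c ∷′ Racc) (Linked.tail Rxs) (Connected.sym id (head′ Rxs))

  Linked-reverse : ∀ {xs} → Linked R xs → Linked (flip R) (reverse xs)
  Linked-reverse {[]}     _   = []
  Linked-reverse {x ∷ xs} Rxs = Linked-reverseAcc (x ∷ xs) [] Rxs just-nothing

↗-unique : ∀ {xs ys} → Linked _≤_ xs → Linked _≤_ ys → xs ↭ ys → xs ≡ ys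
↗-unique xs↗ ys↗ xs↭ys = Pointwise-≡⇒≡ (↗↭↗⇒≋ ≤-totalOrder xs↗ ys↗ (↭⇒↭ₛ xs↭ys))

↘-unique : ∀ {xs ys} → Linked _≥_ xs → Linked _≥_ ys → xs ↭ ys → xs ≡ ys
↘-unique xs↘ ys↘ xs↭ys = Pointwise-≡⇒≡ (↗↭↗⇒≋ (Converse.totalOrder ≤-totalOrder) xs↘ ys↘ (↭⇒↭ₛ xs↭ys))

insertionSort≡sort : ∀ xs → Insertion.sort xs ≡ sort xs
insertionSort≡sort xs = ↗-unique (Insertion.sort-↗ xs) (sort-↗ xs) (↭-trans (Insertion.sort-↭ xs) (↭-sym (sort-↭ xs)))

decreasing-descending : ∀ xs → Linked _≥_ (decreasing xs)
decreasing-descending xs = Linked-reverse (sort-↗ xs)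

decreasing≡descendingSort : ∀ xs → decreasing xs ≡ Descending.sort xs
decreasing≡descendingSort xs = ↘-unique (decreasing-descending xs) (Descending.sort-↗ xs)
  (↭-trans (↭-reverse (sort xs)) (↭-trans (sort-↭ xs) (↭-sym (Descending.sort-↭ xs))))

realizable-assocˡ : ∀ {n} pre x ys → Realizable n (pre ++ x ∷ ys) → Realizable n ((pre ++ [ x ]) ++ ys)
realizable-assocˡ {n} pre x ys = subst (Realizable n) (sym (++-assoc pre [ x ] ys))

realizable-assocʳ : ∀ {n} pre x ys → Realizable n ((pre ++ [ x ]) ++ ys) → Realizable n (pre ++ x ∷ ys)
realizable-assocʳ {n} pre x ys = subst (Realizable n) (++-assoc pre [ x ] ys)

realizable-insert : ∀ {n} pre x ys → Realizable n (pre ++ x ∷ ys) → Realizable n (pre ++ Insertion.insert x ys)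
realizable-insert pre x []       R = R
realizable-insert pre x (y ∷ ys) R with x ≤ᵇ y | ≤ᵇ-reflects-≤ x y
... | true  | _        = R
... | false | ofⁿ x≰y = realizable-assocʳ pre y _
      (realizable-insert (pre ++ [ y ]) x ys (realizable-assocˡ pre y _ (realizable-swap pre x y ys (<⇒≤ (≰⇒> x≰y)) R)))

realizable-insertionSort : ∀ {n} pre xs → Realizable n (pre ++ xs) → Realizable n (pre ++ Insertion.sort xs)
realizable-insertionSort pre []       R = R
realizable-insertionSort pre (x ∷ xs) R = realizable-insert pre x (Insertion.sort xs)
  (realizable-assocʳ pre x _ (realizable-insertionSort (pre ++ [ x ]) xs (realizable-assocˡ pre x xs R)))

realizable-uninsert : ∀ {n} pre x ys → Realizable n (pre ++ Descending.insert x ys) → Realizable n (pre ++ x ∷ ys)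
realizable-uninsert pre x []       R = R
realizable-uninsert pre x (y ∷ ys) R with y ≤ᵇ x | ≤ᵇ-reflects-≤ y x
... | true  | _        = R
... | false | ofⁿ y≰x = realizable-swap pre y x ys (<⇒≤ (≰⇒> y≰x))
      (realizable-assocʳ pre y _ (realizable-uninsert (pre ++ [ y ]) x ys (realizable-assocˡ pre y _ R)))

realizable-unsort : ∀ {n} pre xs → Realizable n (pre ++ Descending.sort xs) → Realizable n (pre ++ xs)
realizable-unsort pre []       R = R
realizable-unsort pre (x ∷ xs) R = realizable-assocʳ pre x xs
  (realizable-unsort (pre ++ [ x ]) xs (realizable-assocˡ pre x _ (realizable-uninsert pre x (Descending.sort xs) R)))

-- Necessity

staircase-descending : ∀ n → Linked _≥_ (staircase n)
staircase-descending zero          = []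
staircase-descending (suc zero)    = [-]
staircase-descending (suc (suc n)) = n≤1+n (suc n) ∷ staircase-descending (suc n)

length-staircase : ∀ n → length (staircase n) ≡ n
length-staircase n = trans (length-map suc (downFrom n)) (length-downFrom n)

sum-take-staircase : ∀ n k → sum (take k (staircase n)) ≡ sumDown id n k
sum-take-staircase zero    zero    = refl
sum-take-staircase zero    (suc k) = sym (sumDown-id-0 k)
  where
    sumDown-id-0 : ∀ k → sumDown id 0 k ≡ 0
    sumDown-id-0 zero    = refl
    sumDown-id-0 (suc k) = sumDown-id-0 k
sum-take-staircase (suc n) zero    = refl
sum-take-staircase (suc n) (suc k) = cong (suc n +_) (sum-take-staircase n k)

decreasing-staircase : ∀ n → decreasing (staircase n) ≡ staircase n
decreasing-staircase n = trans (cong reverse sort≡reverse) (reverse-involutive (staircase n))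
  where
    sort≡reverse : sort (staircase n) ≡ reverse (staircase n)
    sort≡reverse = ↗-unique (sort-↗ (staircase n)) (Linked-reverse (staircase-descending n))
      (↭-trans (sort-↭ (staircase n)) (↭-sym (↭-reverse (staircase n))))

sum-take-decreasing-staircase : ∀ n k → sum (take k (decreasing (staircase n))) ≡ sumDown id n k
sum-take-decreasing-staircase n k = trans (cong (λ l → sum (take k l)) (decreasing-staircase n)) (sum-take-staircase n k)

realizable⇒⪯staircase : ∀ {n xs} → Realizable n xs → xs ⪯⟨ n ⟩ staircase n
realizable⇒⪯staircase {n} {xs} R with realizable-insertionSort [] xs R
... | len , T , mt , E = prefix , total
  where
    c = occurrences T n
    length-sort : length (sort xs) ≡ n
    length-sort = subst (λ l → length l ≡ n) (insertionSort≡sort xs) len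
    length-decreasing : length (decreasing xs) ≡ n
    length-decreasing = trans (length-reverse (sort xs)) length-sort
    down : EnumeratesDown c n (decreasing xs)
    down = subst (λ s → EnumeratesDown c s (decreasing xs)) length-sort
      (EnumeratesDown-reverseAcc c 0 [] (sort xs) tt (subst (Enumerates c 1) (insertionSort≡sort xs) E))
    sum-take-decreasing : ∀ k → k ≤ n → sum (take k (decreasing xs)) ≡ sumDown c n k
    sum-take-decreasing k k≤n = EnumeratesDown-sum-take c n _ k down (subst (k ≤_) (sym length-decreasing) k≤n)
    prefix : ∀ k → 1 ≤ k → k ≤ n → sum (take k (decreasing xs)) ≤ sum (take k (decreasing (staircase n)))
    prefix k _ k≤n = subst₂ _≤_ (sym (sum-take-decreasing k k≤n)) (sym (sum-take-decreasing-staircase n k))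
                       (sumDown-occurrences≤ mt k k≤n)
    total : sum (take n (decreasing xs)) ≡ sum (take n (decreasing (staircase n)))
    total = trans (sum-take-decreasing n ≤-refl)
              (trans (sumDown-occurrences-total mt) (sym (sum-take-decreasing-staircase n n)))

-- Sufficiency

-- Every prefix sum of xs is at most σ plus the corresponding prefix sum of ys, with equality for
-- the whole lists; σ is the slack carried along. Dominated 0 d (staircase n) is majorization.
Dominated : ℕ → List ℕ → List ℕ → Set
Dominated σ []       []       = σ ≡ 0
Dominated σ []       (_ ∷ _)  = ⊥
Dominated σ (_ ∷ _)  []       = ⊥
Dominated σ (x ∷ xs) (y ∷ ys) = x ≤ σ + y × Dominated (σ + y ∸ x) xs ys

prefixSums⇒Dominated : ∀ σ xs ys → length xs ≡ length ys → (∀ k → sum (take k xs) ≤ σ + sum (take k ys)) →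
  sum xs ≡ σ + sum ys → Dominated σ xs ys
prefixSums⇒Dominated σ []       []       _   _      total = sym (trans total (+-identityʳ σ))
prefixSums⇒Dominated σ (x ∷ xs) (y ∷ ys) len prefix total =
  x≤σ+y , prefixSums⇒Dominated σ' xs ys (suc-injective len) prefix' total'
  where
    x≤σ+y : x ≤ σ + y
    x≤σ+y = subst₂ _≤_ (+-identityʳ x) (cong (σ +_) (+-identityʳ y)) (prefix 1)
    σ' = σ + y ∸ x
    split : ∀ s → σ + (y + s) ≡ x + (σ' + s)
    split s = trans (sym (+-assoc σ y s)) (trans (cong (_+ s) (sym (m+[n∸m]≡n x≤σ+y))) (+-assoc x σ' s))
    prefix' : ∀ k → sum (take k xs) ≤ σ' + sum (take k ys)
    prefix' k = +-cancelˡ-≤ x _ _ (subst (x + sum (take k xs) ≤_) (split _) (prefix (suc k)))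
    total' : sum xs ≡ σ' + sum ys
    total' = +-cancelˡ-≡ x _ _ (trans total (split _))

Dominated-head≤ : ∀ σ c w m → Dominated σ (c ∷ w) (staircase m) → c ≤ σ + m
Dominated-head≤ σ c w (suc m) (c≤ , _) = c≤

-- w' is w with one unit handed over to x.
record Borrowing (n : ℕ) (pre : List ℕ) (x : ℕ) (w : List ℕ) (m σ : ℕ) : Set where
  field
    w'          : List ℕ
    dominated   : Dominated σ w' (staircase m)
    length-eq   : length w' ≡ length w
    descending  : ∀ z → Linked _≥_ (z ∷ w) → Linked _≥_ (z ∷ w')
    realizes    : Realizable n (pre ++ suc x ∷ w') → Realizable n (pre ++ x ∷ w)

[1+m]∸n≡1+o⇒n≤m∧m∸n≡o : ∀ m n o → suc m ∸ n ≡ suc o → n ≤ m × m ∸ n ≡ o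
[1+m]∸n≡1+o⇒n≤m∧m∸n≡o m n o eq = n≤m , suc-injective (trans (sym (+-∸-assoc 1 n≤m)) eq)
  where
    n≤m : n ≤ m
    n≤m = ≤-pred (m∸n≢0⇒n<m (λ e → 0≢1+n (trans (sym e) eq)))

-- The unit is taken from the first entry at which the slack drops to 0, and carried back to x.
borrow : ∀ {n} pre x w m σ → Dominated (suc σ) w (staircase m) → Linked _≥_ (x ∷ w) → Borrowing n pre x w m σ
borrow pre x []       zero    σ () _
borrow pre x (b ∷ w₂) (suc m) σ (b≤ , dom) desc with suc σ + suc m ∸ b in slack
... | zero   = tight (≤-antisym b≤ (m∸n≡0⇒m≤n slack)) dom desc
  where
    tight : ∀ {b} → b ≡ suc σ + suc m → Dominated 0 w₂ (staircase m) → Linked _≥_ (x ∷ b ∷ w₂) →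
      Borrowing _ pre x (b ∷ w₂) (suc m) σ
    tight refl dom (b≤x ∷ desc₂) = record
      { w'          = σ + suc m ∷ w₂
      ; dominated   = ≤-refl , subst (λ t → Dominated t w₂ (staircase m)) (sym (n∸n≡0 (σ + suc m))) dom
      ; length-eq   = refl
      ; descending  = λ { z (b≤z ∷ _) → ≤-trans (n≤1+n _) b≤z ∷ below desc₂ }
      ; realizes    = realizable-carry pre x (σ + suc m) w₂ (≤-trans (n≤1+n _) b≤x)
      }
      where
        below : Linked _≥_ (suc (σ + suc m) ∷ w₂) → Linked _≥_ (σ + suc m ∷ w₂)
        below [-] = [-]
        below (_ ∷ desc₃) = ≤-trans (Dominated-head≤ 0 _ _ m dom) (≤-trans (n≤1+n m) (m≤n+m (suc m) σ)) ∷ desc₃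
... | suc s  with [1+m]∸n≡1+o⇒n≤m∧m∸n≡o (σ + suc m) b s slack
                | borrow (pre ++ [ x ]) b w₂ m s dom (Linked.tail desc)
...   | b≤σ+1+m , σ' | B = record
      { w'          = b ∷ w'
      ; dominated   = b≤σ+1+m , subst (λ t → Dominated t w' (staircase m)) (sym σ') dominated
      ; length-eq   = cong suc length-eq
      ; descending  = λ { z (b≤z ∷ desc₂) → b≤z ∷ descending b desc₂ }
      ; realizes    = λ R → realizable-assocʳ pre x _
          (realizes (realizable-assocˡ pre x _ (realizable-carry pre x b w' (Linked.head desc) R)))
      }
  where open Borrowing B

realizable-descending : ∀ n d → length d ≡ n → Linked _≥_ d → Dominated 0 d (staircase n) → Realizable n d
realizable-descending zero    []      _   _    _              = realizable-[]
realizable-descending (suc m) (a ∷ w) len desc (a≤1+m , dom) =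
  raise (suc m ∸ a) a w (m∸n+n≡m a≤1+m) (suc-injective len) desc dom
  where
    raise : ∀ d a w → d + a ≡ suc m → length w ≡ m → Linked _≥_ (a ∷ w) → Dominated d w (staircase m) →
      Realizable (suc m) (a ∷ w)
    raise zero    a w refl len desc dom = realizable-lift m w (realizable-descending m w len (Linked.tail desc) dom)
    raise (suc d) a w d+a≡ len desc dom = realizes
      (raise d (suc a) w' (trans (+-suc d a) d+a≡) (trans length-eq len)
             (descending (suc a) (raise-head desc)) dominated)
      where
        open Borrowing (borrow [] a w m d dom desc)
        raise-head : ∀ {a w} → Linked _≥_ (a ∷ w) → Linked _≥_ (suc a ∷ w)
        raise-head [-]          = [-]
        raise-head (c≤a ∷ desc) = ≤-trans c≤a (n≤1+n _) ∷ desc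

sum-take-all : ∀ k xs → length xs ≤ k → sum (take k xs) ≡ sum xs
sum-take-all k xs |xs|≤k = cong sum (take-all k xs |xs|≤k)

⪯staircase⇒realizable : ∀ {n xs} → length xs ≡ n → xs ⪯⟨ n ⟩ staircase n → Realizable n xs
⪯staircase⇒realizable {n} {xs} len (prefix , total) =
  realizable-unsort [] xs (subst (Realizable n) (decreasing≡descendingSort xs)
    (realizable-descending n (decreasing xs) length-decreasing (decreasing-descending xs) dominated))
  where
    length-decreasing : length (decreasing xs) ≡ n
    length-decreasing = trans (length-reverse (sort xs)) (trans (↭-length (sort-↭ xs)) len)
    sum-decreasing : sum (decreasing xs) ≡ sum (staircase n)
    sum-decreasing = begin
      sum (decreasing xs)                           ≡⟨ sum-take-all n _ (≤-reflexive length-decreasing) ⟨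
      sum (take n (decreasing xs))                  ≡⟨ total ⟩
      sum (take n (decreasing (staircase n)))       ≡⟨ cong (λ l → sum (take n l)) (decreasing-staircase n) ⟩
      sum (take n (staircase n))                    ≡⟨ sum-take-all n _ (≤-reflexive (length-staircase n)) ⟩
      sum (staircase n)                             ∎
      where open ≡-Reasoning
    prefix' : ∀ k → sum (take k (decreasing xs)) ≤ sum (take k (staircase n))
    prefix' zero    = z≤n
    prefix' (suc k) with suc k ≤? n
    ... | yes 1+k≤n = subst (sum (take (suc k) (decreasing xs)) ≤_)
      (cong (λ l → sum (take (suc k) l)) (decreasing-staircase n)) (prefix (suc k) (s≤s z≤n) 1+k≤n)
    ... | no  1+k≰n = subst₂ _≤_
      (sym (sum-take-all (suc k) (decreasing xs) (≤-trans (≤-reflexive length-decreasing) n≤1+k)))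
      (sym (sum-take-all (suc k) (staircase n) (≤-trans (≤-reflexive (length-staircase n)) n≤1+k)))
      (≤-reflexive sum-decreasing)
      where
        n≤1+k : n ≤ suc k
        n≤1+k = <⇒≤ (≰⇒> 1+k≰n)
    dominated : Dominated 0 (decreasing xs) (staircase n)
    dominated = prefixSums⇒Dominated 0 _ _ (trans length-decreasing (sym (length-staircase n))) prefix' sum-decreasing

corollary2p8 : (n : ℕ) (v : Fin n → ℕ) →
    (Σ Array λ T → MonotoneTriangle n T × (∀ (k : Fin n) → occurrences T n (suc (toℕ k)) ≡ v k))
      ⇔ (vecList v ⪯⟨ n ⟩ staircase n)
corollary2p8 n v = mk⇔
  (λ (T , mt , occ) →
     realizable⇒⪯staircase (length-tabulate v , T , mt , Enumerates-tabulate⁺ (occurrences T n) 1 v occ))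
  (λ majorized → let (_ , T , mt , E) = ⪯staircase⇒realizable (length-tabulate v) majorized
                 in T , mt , Enumerates-tabulate⁻ (occurrences T n) 1 v E)
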